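{- Let $G_{\mathcal{F}}=(V,\mathcal{F})$ be a simple graph with $m=|\mathcal{F}|\ge 1$ edges and degrees $(d_1,\dots,d_n)$, and let $\delta$ be defined by $\frac{1}{m}\sum_u d_u^2=m+1-\delta$. Then there exists an edge $\{u,v\}\in\mathcal{F}$ with $d_u+d_v-1\ge m-\delta$. Furthermore, if $\delta<\frac12$, then $\delta=0$ and $G_{\mathcal{F}}$ (ignoring isolated vertices) is either a star or a triangle. -}

module Defs where

open import Data.Nat using (ℕ; suc; _+_; _*_; _<_; NonZero)
open import Data.Fin using (Fin; toℕ; _≟_)
open import Data.Fin.Base using () renaming (_<_ to _<ᶠ_)
open import Data.List using (List; length; filter; map; allFin)
open import Data.Nat.ListAction using (sum)
open import Data.List.Relation.Unary.All using (All)
open import Data.List.Relation.Unary.Unique.Propositional using (Unique)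
open import Data.List.Membership.Propositional using (_∈_)
open import Data.Product using (_×_; _,_; proj₁; proj₂; ∃)
open import Data.Sum using (_⊎_)
open import Data.Integer using (+_)
open import Data.Rational using (ℚ; _/_; _-_)
open import Relation.Binary.PropositionalEquality using (_≡_)
open import Relation.Nullary.Decidable using (_⊎-dec_)

-- A simple graph on vertex set Fin n: a duplicate-free list of edges,
-- each edge {u,v} stored once as the ordered pair (u , v) with u < v.
Edge : ℕ → Set
Edge n = Fin n × Fin n

record SimpleGraph (n : ℕ) : Set where
  constructor mkGraph
  field
    edges   : List (Edge n)
    ordered : All (λ e → toℕ (proj₁ e) < toℕ (proj₂ e)) edges
    unique  : Unique edges
open SimpleGraph public

numEdges : ∀ {n} → SimpleGraph n → ℕ
numEdges G = length (edges G)

Incident : ∀ {n} → Fin n → Edge n → Set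
Incident u e = (u ≡ proj₁ e) ⊎ (u ≡ proj₂ e)

degree : ∀ {n} → SimpleGraph n → Fin n → ℕ
degree G u = length (filter (λ e → (u ≟ proj₁ e) ⊎-dec (u ≟ proj₂ e)) (edges G))

sumSqDeg : ∀ {n} → SimpleGraph n → ℕ
sumSqDeg {n} G = sum (map (λ u → degree G u * degree G u) (allFin n))

ℕ→ℚ : ℕ → ℚ
ℕ→ℚ k = + k / 1

delta : ∀ {n} (G : SimpleGraph n) → .{{_ : NonZero (numEdges G)}} → ℚ
delta G = ℕ→ℚ (numEdges G + 1) - ((+ sumSqDeg G) / numEdges G)

IsStar : ∀ {n} → SimpleGraph n → Set
IsStar {n} G = ∃ λ (c : Fin n) → All (Incident c) (edges G)

IsTriangle : ∀ {n} → SimpleGraph n → Set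
IsTriangle {n} G = (numEdges G ≡ 3) × (∃ λ (a : Fin n) → ∃ λ (b : Fin n) → ∃ λ (c : Fin n) →
  (toℕ a < toℕ b) × (toℕ b < toℕ c) ×
  ((a , b) ∈ edges G) × ((b , c) ∈ edges G) × ((a , c) ∈ edges G))

module Submission where

-- Call an edge g disjoint from e = {a, b} if it avoids both a and b. Every edge other than e meets a, meets b,
-- or is disjoint from e, and only e meets both, so d_a + d_b + dis(e) = m + 1, where dis(e) is the number of
-- edges disjoint from e. Double counting gives Σ_u d_u² = Σ_{ab} (d_a + d_b) = m(m + 1) − D with
-- D = Σ_e dis(e), so δ = D / m, and an edge maximising d_a + d_b is at least as large as the average m + 1 − δ.
-- If D > 0, take disjoint edges e and f. Every edge g with dis(g) = 0 joins an endpoint of e to an endpoint of f,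
-- and these edges pairwise meet; but three pairwise meeting crossings of e and f do not exist. So at most two
-- edges have dis = 0, at least two (e and f) have dis ≥ 1, and m ≤ 2D, i.e. δ ≥ 1/2. Hence δ < 1/2 forces D = 0:
-- the edges pairwise intersect, and a pairwise intersecting family of 2-sets is a star or a triangle.

open import Defs
open import Data.Nat using (ℕ; zero; suc; NonZero; _+_; _*_)
import Data.Nat as ℕ
import Data.Nat.Properties as ℕ
open import Data.Nat.ListAction using (sum)
open import Data.Bool using (Bool; true; false; if_then_else_; _xor_)
open import Data.Bool.Properties using (xor-∧-commutativeRing)
open import Data.Fin using (Fin; toℕ; _≟_)
import Data.Fin as Fin
open import Data.Fin.Properties using (toℕ-injective)
open import Data.List using (List; []; _∷_; length; filter; map; allFin; tabulate)
import Data.List.Properties as List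
open import Data.List.Relation.Unary.All using (All; []; _∷_)
import Data.List.Relation.Unary.All as All
import Data.List.Relation.Unary.All.Properties as All
open import Data.List.Relation.Unary.Any using (here; there)
open import Data.List.Relation.Unary.AllPairs using ([]; _∷_)
open import Data.List.Relation.Unary.Unique.Propositional using (Unique)
open import Data.List.Relation.Unary.Unique.Propositional.Properties using (filter⁺)
open import Data.List.Relation.Binary.Subset.Propositional using (_⊆_)
open import Data.List.Membership.Propositional using (_∈_; find; lose)
open import Data.List.Membership.Propositional.Properties using (∈-filter⁺; ∈-filter⁻)
open import Data.Product using (_×_; _,_; proj₁; proj₂; ∃)
open import Data.Product.Properties using (≡-dec)
open import Data.Sum using (_⊎_; inj₁; inj₂; [_,_]′)
open import Data.Empty using (⊥; ⊥-elim)
open import Function using (_∘_)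
open import Function.Bundles using (_⇔_; mk⇔; Equivalence)
open import Relation.Nullary using (Dec; yes; no; does; ¬_)
open import Relation.Nullary.Decidable using (_⊎-dec_; _×-dec_; ¬?)
open import Relation.Unary.Properties using (∁?)
open import Relation.Binary.Definitions using (DecidableEquality; tri<; tri≈; tri>)
open import Relation.Binary.PropositionalEquality
open import Algebra.Bundles using (CommutativeRing)
open import Algebra.Properties.CommutativeSemigroup ℕ.+-commutativeSemigroup using (interchange)
open import Algebra.Properties.Group (CommutativeRing.+-group xor-∧-commutativeRing) using (∙-cancelˡ; ∙-cancelʳ)

𝟙 : ∀ {p} {P : Set p} → Dec P → ℕ
𝟙 P? = if does P? then 1 else 0

𝟙-cong : ∀ {p q} {P : Set p} {Q : Set q} (P? : Dec P) (Q? : Dec Q) → P ⇔ Q → 𝟙 P? ≡ 𝟙 Q?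
𝟙-cong (yes _) (yes _) _   = refl
𝟙-cong (no _)  (no _)  _   = refl
𝟙-cong (yes p) (no ¬q) p⇔q = ⊥-elim (¬q (Equivalence.to p⇔q p))
𝟙-cong (no ¬p) (yes q) p⇔q = ⊥-elim (¬p (Equivalence.from p⇔q q))

𝟙-inclusion-exclusion : ∀ {p q} {P : Set p} {Q : Set q} (P? : Dec P) (Q? : Dec Q) →
  𝟙 P? + 𝟙 Q? + 𝟙 (¬? P? ×-dec ¬? Q?) ≡ 1 + 𝟙 (P? ×-dec Q?)
𝟙-inclusion-exclusion (yes _) (yes _) = refl
𝟙-inclusion-exclusion (yes _) (no _)  = refl
𝟙-inclusion-exclusion (no _)  (yes _) = refl
𝟙-inclusion-exclusion (no _)  (no _)  = refl

bool-pigeonhole : ∀ (x y z : Bool) → x ≢ y → x ≢ z → y ≢ z → ⊥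
bool-pigeonhole false false _     x≢y _   _   = x≢y refl
bool-pigeonhole true  true  _     x≢y _   _   = x≢y refl
bool-pigeonhole false true  false _   x≢z _   = x≢z refl
bool-pigeonhole true  false true  _   x≢z _   = x≢z refl
bool-pigeonhole false true  true  _   _   y≢z = y≢z refl
bool-pigeonhole true  false false _   _   y≢z = y≢z refl

module _ {A : Set} where

  open import Data.Nat using (_≤_; z≤n; s≤s)

  length-filter-∷ : ∀ {P : A → Set} (P? : ∀ x → Dec (P x)) x xs →
    length (filter P? (x ∷ xs)) ≡ 𝟙 (P? x) + length (filter P? xs)
  length-filter-∷ P? x xs with P? x
  ... | yes _ = refl
  ... | no  _ = refl

  length-filter+length-filter-∁ : ∀ {P : A → Set} (P? : ∀ x → Dec (P x)) xs →
    length (filter P? xs) + length (filter (∁? P?) xs) ≡ length xs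
  length-filter+length-filter-∁ P? []       = refl
  length-filter+length-filter-∁ P? (x ∷ xs) with does (P? x)
  ... | true  = cong suc (length-filter+length-filter-∁ P? xs)
  ... | false = trans (ℕ.+-suc _ _) (cong suc (length-filter+length-filter-∁ P? xs))

  ∃-of-length-filter≢0 : ∀ {P : A → Set} (P? : ∀ x → Dec (P x)) xs →
    length (filter P? xs) ≢ 0 → ∃ λ x → x ∈ xs × P x
  ∃-of-length-filter≢0 P? xs length≢0 with filter P? xs in eq
  ... | []    = ⊥-elim (length≢0 refl)
  ... | y ∷ _ = y , ∈-filter⁻ P? (subst (y ∈_) (sym eq) (here refl))

  sum-map-+ : ∀ (f g : A → ℕ) xs →
    sum (map (λ x → f x + g x) xs) ≡ sum (map f xs) + sum (map g xs)
  sum-map-+ f g []       = refl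
  sum-map-+ f g (x ∷ xs) = trans (cong (f x + g x +_) (sum-map-+ f g xs))
    (interchange (f x) (g x) (sum (map f xs)) (sum (map g xs)))

  sum-map-const : ∀ {f : A → ℕ} {c xs} → All (λ x → f x ≡ c) xs → sum (map f xs) ≡ length xs * c
  sum-map-const []           = refl
  sum-map-const (fx≡c ∷ fxs) = cong₂ _+_ fx≡c (sum-map-const fxs)

  sum-map≡0⇒≡0 : ∀ (f : A → ℕ) {x} xs → sum (map f xs) ≡ 0 → x ∈ xs → f x ≡ 0
  sum-map≡0⇒≡0 f (y ∷ xs) sum≡0 (here refl)  = ℕ.m+n≡0⇒m≡0 (f y) sum≡0
  sum-map≡0⇒≡0 f (y ∷ xs) sum≡0 (there x∈xs) = sum-map≡0⇒≡0 f xs (ℕ.m+n≡0⇒n≡0 (f y) sum≡0) x∈xs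

  ∃-of-sum≢0 : ∀ (f : A → ℕ) xs → sum (map f xs) ≢ 0 → ∃ λ x → x ∈ xs × f x ≢ 0
  ∃-of-sum≢0 f []       sum≢0 = ⊥-elim (sum≢0 refl)
  ∃-of-sum≢0 f (x ∷ xs) sum≢0 with f x ℕ.≟ 0
  ... | no  fx≢0 = x , here refl , fx≢0
  ... | yes fx≡0 with y , y∈xs , fy≢0 ← ∃-of-sum≢0 f xs (λ rest≡0 → sum≢0 (cong₂ _+_ fx≡0 rest≡0))
                 = y , there y∈xs , fy≢0

  length-filter-≢0≤sum : ∀ (f : A → ℕ) xs → length (filter (λ x → ¬? (f x ℕ.≟ 0)) xs) ≤ sum (map f xs)
  length-filter-≢0≤sum f []       = z≤n
  length-filter-≢0≤sum f (x ∷ xs) with f x | length-filter-≢0≤sum f xs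
  ... | zero  | ih = ih
  ... | suc k | ih = s≤s (ℕ.≤-trans ih (ℕ.m≤n+m _ k))

  ∃-sum≤length* : ∀ (f : A → ℕ) xs .{{_ : NonZero (length xs)}} →
    ∃ λ x → x ∈ xs × sum (map f xs) ≤ length xs * f x
  ∃-sum≤length* f []                = ⊥-elim (ℕ.≢-nonZero⁻¹ 0 refl)
  ∃-sum≤length* f (x ∷ [])          = x , here refl , ℕ.≤-refl
  ∃-sum≤length* f (x ∷ xs@(_ ∷ _)) with y , y∈xs , sum≤ ← ∃-sum≤length* f xs | f y ℕ.≤? f x
  ... | yes fy≤fx = x , here refl , ℕ.+-monoʳ-≤ (f x) (ℕ.≤-trans sum≤ (ℕ.*-monoʳ-≤ (length xs) fy≤fx))
  ... | no  fy≰fx = y , there y∈xs , ℕ.+-mono-≤ (ℕ.<⇒≤ (ℕ.≰⇒> fy≰fx)) sum≤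

  module _ (_≟ᴬ_ : DecidableEquality A) where

    count-unique : ∀ {x} {xs : List A} → Unique xs → x ∈ xs → length (filter (_≟ᴬ x) xs) ≡ 1
    count-unique {x} (x∉xs ∷ _) (here refl) = cong length (trans (List.filter-accept (_≟ᴬ x) refl)
      (cong (x ∷_) (List.filter-none (_≟ᴬ x) (All.map (λ x≢y y≡x → x≢y (sym y≡x)) x∉xs))))
    count-unique {x} (y∉xs ∷ xs-unique) (there x∈xs) =
      trans (cong length (List.filter-reject (_≟ᴬ x) (All.lookup y∉xs x∈xs))) (count-unique xs-unique x∈xs)

    length-≤-⊆ : ∀ {xs ys : List A} → Unique ys → ys ⊆ xs → length ys ≤ length xs
    length-≤-⊆ {xs} {[]}     _                  _     = z≤n
    length-≤-⊆ {xs} {y ∷ ys} (y∉ys ∷ ys-unique) ys⊆xs = ℕ.≤-trans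
      (s≤s (length-≤-⊆ ys-unique λ z∈ys → ∈-filter⁺ (λ x → ¬? (x ≟ᴬ y)) (ys⊆xs (there z∈ys))
                                                    (λ z≡y → All.lookup y∉ys z∈ys (sym z≡y))))
      (List.filter-notAll (λ x → ¬? (x ≟ᴬ y)) xs (lose (ys⊆xs (here refl)) (λ y≢y → y≢y refl)))

sum-tabulate-0 : ∀ n → sum (tabulate {n = n} (λ _ → 0)) ≡ 0
sum-tabulate-0 zero    = refl
sum-tabulate-0 (suc n) = sum-tabulate-0 n

sum-tabulate-𝟙≟ : ∀ {n} (a : Fin n) (w : Fin n → ℕ) → sum (tabulate (λ u → 𝟙 (u ≟ a) * w u)) ≡ w a
sum-tabulate-𝟙≟ {suc n} Fin.zero w = begin
  w Fin.zero + 0 + sum (tabulate {n = n} (λ _ → 0)) ≡⟨ cong (w Fin.zero + 0 +_) (sum-tabulate-0 n) ⟩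
  w Fin.zero + 0 + 0                               ≡⟨ cong (_+ 0) (ℕ.+-identityʳ _) ⟩
  w Fin.zero + 0                                   ≡⟨ ℕ.+-identityʳ _ ⟩
  w Fin.zero                                       ∎
  where open ≡-Reasoning
sum-tabulate-𝟙≟ {suc n} (Fin.suc a) w = sum-tabulate-𝟙≟ a (w ∘ Fin.suc)

sum-allFin-𝟙≟ : ∀ {n} (a : Fin n) (w : Fin n → ℕ) → sum (map (λ u → 𝟙 (u ≟ a) * w u) (allFin n)) ≡ w a
sum-allFin-𝟙≟ a w = trans (cong sum (List.map-tabulate (λ u → u) (λ u → 𝟙 (u ≟ a) * w u))) (sum-tabulate-𝟙≟ a w)

module _ {n : ℕ} where

  open import Data.Nat using (_≤_; _<_; z≤n; s≤s)

  Ordered : Edge n → Set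
  Ordered e = toℕ (proj₁ e) < toℕ (proj₂ e)

  Loopless : Edge n → Set
  Loopless e = proj₁ e ≢ proj₂ e

  ordered⇒loopless : ∀ {e} → Ordered e → Loopless e
  ordered⇒loopless e< a≡b = ℕ.<-irrefl (cong toℕ a≡b) e<

  _≟ₑ_ : DecidableEquality (Edge n)
  _≟ₑ_ = ≡-dec _≟_ _≟_

  incident? : (u : Fin n) (e : Edge n) → Dec (Incident u e)
  incident? u e = (u ≟ proj₁ e) ⊎-dec (u ≟ proj₂ e)

  degreeIn : List (Edge n) → Fin n → ℕ
  degreeIn E u = length (filter (incident? u) E)

  Disjoint : Edge n → Edge n → Set
  Disjoint e g = ¬ Incident (proj₁ e) g × ¬ Incident (proj₂ e) g

  disjoint? : (e g : Edge n) → Dec (Disjoint e g)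
  disjoint? e g = ¬? (incident? (proj₁ e) g) ×-dec ¬? (incident? (proj₂ e) g)

  disjointCount : List (Edge n) → Edge n → ℕ
  disjointCount E e = length (filter (disjoint? e) E)

  disjointPairs : List (Edge n) → ℕ
  disjointPairs E = sum (map (disjointCount E) E)

  Meets : Edge n → Edge n → Set
  Meets g h = ∃ λ v → Incident v g × Incident v h

  meets-sym : ∀ {g h} → Meets g h → Meets h g
  meets-sym (v , v∈g , v∈h) = v , v∈h , v∈g

  meets-edge : ∀ {g a b} → Meets g (a , b) → Incident a g ⊎ Incident b g
  meets-edge (_ , v∈g , inj₁ refl) = inj₁ v∈g
  meets-edge (_ , v∈g , inj₂ refl) = inj₂ v∈g

  disjoint-≢ : ∀ {e f u v} → Disjoint e f → Incident u e → Incident v f → u ≢ v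
  disjoint-≢ (a∉f , _) (inj₁ refl) v∈f refl = a∉f v∈f
  disjoint-≢ (_ , b∉f) (inj₂ refl) v∈f refl = b∉f v∈f

  disjoint⇒¬meets : ∀ {e f} → Disjoint e f → ¬ Meets e f
  disjoint⇒¬meets e∩f=∅ (v , v∈e , v∈f) = disjoint-≢ e∩f=∅ v∈e v∈f refl

  disjointCount≡0⇒meets : ∀ {E g h} → disjointCount E g ≡ 0 → h ∈ E → Meets g h
  disjointCount≡0⇒meets {E} {g} {h} count≡0 h∈E with incident? (proj₁ g) h | incident? (proj₂ g) h
  ... | yes a∈h | _       = proj₁ g , inj₁ refl , a∈h
  ... | no  _   | yes b∈h = proj₂ g , inj₂ refl , b∈h
  ... | no  a∉h | no  b∉h =
    ⊥-elim (ℕ.<⇒≢ (List.filter-some (disjoint? g) (lose h∈E (a∉h , b∉h))) (sym count≡0))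

  incident-one-of : ∀ {u v x} (g : Edge n) → u ≢ v → Incident u g → Incident v g → Incident x g → x ≡ u ⊎ x ≡ v
  incident-one-of g u≢v (inj₁ refl) (inj₁ refl) _           = ⊥-elim (u≢v refl)
  incident-one-of g u≢v (inj₂ refl) (inj₂ refl) _           = ⊥-elim (u≢v refl)
  incident-one-of g u≢v (inj₁ refl) (inj₂ refl) (inj₁ refl) = inj₁ refl
  incident-one-of g u≢v (inj₁ refl) (inj₂ refl) (inj₂ refl) = inj₂ refl
  incident-one-of g u≢v (inj₂ refl) (inj₁ refl) (inj₁ refl) = inj₂ refl
  incident-one-of g u≢v (inj₂ refl) (inj₁ refl) (inj₂ refl) = inj₁ refl

  ordered-edge-≡ : ∀ {u v} (g : Edge n) → Ordered g → toℕ u < toℕ v → Incident u g → Incident v g → g ≡ (u , v)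
  ordered-edge-≡ g g< u<v (inj₁ refl) (inj₁ refl) = ⊥-elim (ℕ.<-irrefl refl u<v)
  ordered-edge-≡ g g< u<v (inj₁ refl) (inj₂ refl) = refl
  ordered-edge-≡ g g< u<v (inj₂ refl) (inj₁ refl) = ⊥-elim (ℕ.<-asym u<v g<)
  ordered-edge-≡ g g< u<v (inj₂ refl) (inj₂ refl) = ⊥-elim (ℕ.<-irrefl refl u<v)

  ordered-edges-≡ : ∀ {u v} (g h : Edge n) → Ordered g → Ordered h → u ≢ v →
    Incident u g → Incident v g → Incident u h → Incident v h → g ≡ h
  ordered-edges-≡ {u} {v} g h g< h< u≢v u∈g v∈g u∈h v∈h with ℕ.<-cmp (toℕ u) (toℕ v)
  ... | tri< u<v _ _ = trans (ordered-edge-≡ g g< u<v u∈g v∈g) (sym (ordered-edge-≡ h h< u<v u∈h v∈h))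
  ... | tri≈ _ u≡v _ = ⊥-elim (u≢v (toℕ-injective u≡v))
  ... | tri> _ _ v<u = trans (ordered-edge-≡ g g< v<u v∈g u∈g) (sym (ordered-edge-≡ h h< v<u v∈h u∈h))

  sum-incident : ∀ e → Loopless e → (w : Fin n → ℕ) →
    sum (map (λ u → 𝟙 (incident? u e) * w u) (allFin n)) ≡ w (proj₁ e) + w (proj₂ e)
  sum-incident (a , b) a≢b w = begin
    sum (map (λ u → 𝟙 (incident? u (a , b)) * w u) (allFin n))
      ≡⟨ cong sum (List.map-cong endpoints (allFin n)) ⟩
    sum (map (λ u → 𝟙 (u ≟ a) * w u + 𝟙 (u ≟ b) * w u) (allFin n))
      ≡⟨ sum-map-+ (λ u → 𝟙 (u ≟ a) * w u) (λ u → 𝟙 (u ≟ b) * w u) (allFin n) ⟩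
    sum (map (λ u → 𝟙 (u ≟ a) * w u) (allFin n)) + sum (map (λ u → 𝟙 (u ≟ b) * w u) (allFin n))
      ≡⟨ cong₂ _+_ (sum-allFin-𝟙≟ a w) (sum-allFin-𝟙≟ b w) ⟩
    w a + w b ∎
    where
    open ≡-Reasoning
    𝟙-incident : ∀ u → 𝟙 (incident? u (a , b)) ≡ 𝟙 (u ≟ a) + 𝟙 (u ≟ b)
    𝟙-incident u with u ≟ a | u ≟ b
    ... | yes refl | yes refl = ⊥-elim (a≢b refl)
    ... | yes _    | no  _    = refl
    ... | no  _    | yes _    = refl
    ... | no  _    | no  _    = refl
    endpoints : ∀ u → 𝟙 (incident? u (a , b)) * w u ≡ 𝟙 (u ≟ a) * w u + 𝟙 (u ≟ b) * w u
    endpoints u = trans (cong (_* w u) (𝟙-incident u)) (ℕ.*-distribʳ-+ (w u) (𝟙 (u ≟ a)) (𝟙 (u ≟ b)))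

  sum-degreeIn-* : ∀ E → All Loopless E → (w : Fin n → ℕ) →
    sum (map (λ u → degreeIn E u * w u) (allFin n)) ≡ sum (map (λ e → w (proj₁ e) + w (proj₂ e)) E)
  sum-degreeIn-* []      []                        w =
    trans (cong sum (List.map-tabulate {n = n} (λ u → u) (λ _ → 0))) (sum-tabulate-0 n)
  sum-degreeIn-* (e ∷ E) (e-loopless ∷ E-loopless) w = begin
    sum (map (λ u → degreeIn (e ∷ E) u * w u) (allFin n))
      ≡⟨ cong sum (List.map-cong split (allFin n)) ⟩
    sum (map (λ u → 𝟙 (incident? u e) * w u + degreeIn E u * w u) (allFin n))
      ≡⟨ sum-map-+ (λ u → 𝟙 (incident? u e) * w u) (λ u → degreeIn E u * w u) (allFin n) ⟩
    sum (map (λ u → 𝟙 (incident? u e) * w u) (allFin n)) + sum (map (λ u → degreeIn E u * w u) (allFin n))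
      ≡⟨ cong₂ _+_ (sum-incident e e-loopless w) (sum-degreeIn-* E E-loopless w) ⟩
    w (proj₁ e) + w (proj₂ e) + sum (map (λ e → w (proj₁ e) + w (proj₂ e)) E) ∎
    where
    open ≡-Reasoning
    split : ∀ u → degreeIn (e ∷ E) u * w u ≡ 𝟙 (incident? u e) * w u + degreeIn E u * w u
    split u = trans (cong (_* w u) (length-filter-∷ (incident? u) e E))
                    (ℕ.*-distribʳ-+ (w u) (𝟙 (incident? u e)) (degreeIn E u))

  𝟙-incident+𝟙-disjoint : ∀ {a b} (g : Edge n) → Ordered g → toℕ a < toℕ b →
    𝟙 (incident? a g) + 𝟙 (incident? b g) + 𝟙 (disjoint? (a , b) g) ≡ 1 + 𝟙 (g ≟ₑ (a , b))
  𝟙-incident+𝟙-disjoint {a} {b} g g< a<b =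
    trans (𝟙-inclusion-exclusion (incident? a g) (incident? b g))
          (cong suc (𝟙-cong (incident? a g ×-dec incident? b g) (g ≟ₑ (a , b)) incident-both⇔≡))
    where
    incident-both⇔≡ : (Incident a g × Incident b g) ⇔ (g ≡ (a , b))
    incident-both⇔≡ = mk⇔ (λ (a∈g , b∈g) → ordered-edge-≡ g g< a<b a∈g b∈g) (λ { refl → inj₁ refl , inj₂ refl })

  degreeIn-+-disjointCount : ∀ E {a b} → All Ordered E → toℕ a < toℕ b →
    degreeIn E a + degreeIn E b + disjointCount E (a , b) ≡ length E + length (filter (_≟ₑ (a , b)) E)
  degreeIn-+-disjointCount []      _                  _   = refl
  degreeIn-+-disjointCount (g ∷ E) {a} {b} (g< ∷ E<) a<b = begin
    degreeIn (g ∷ E) a + degreeIn (g ∷ E) b + disjointCount (g ∷ E) (a , b)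
      ≡⟨ cong₂ _+_ (cong₂ _+_ (length-filter-∷ (incident? a) g E) (length-filter-∷ (incident? b) g E))
                   (length-filter-∷ (disjoint? (a , b)) g E) ⟩
    (ia + da) + (ib + db) + (i∅ + d∅)
      ≡⟨ cong (_+ (i∅ + d∅)) (interchange ia da ib db) ⟩
    (ia + ib) + (da + db) + (i∅ + d∅)
      ≡⟨ interchange (ia + ib) (da + db) i∅ d∅ ⟩
    (ia + ib + i∅) + (da + db + d∅)
      ≡⟨ cong₂ _+_ (𝟙-incident+𝟙-disjoint g g< a<b) (degreeIn-+-disjointCount E E< a<b) ⟩
    (1 + 𝟙 (g ≟ₑ (a , b))) + (length E + count)
      ≡⟨ interchange 1 (𝟙 (g ≟ₑ (a , b))) (length E) count ⟩
    suc (length E) + (𝟙 (g ≟ₑ (a , b)) + count)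
      ≡⟨ cong (suc (length E) +_) (length-filter-∷ (_≟ₑ (a , b)) g E) ⟨
    length (g ∷ E) + length (filter (_≟ₑ (a , b)) (g ∷ E)) ∎
    where
    open ≡-Reasoning
    ia ib i∅ da db d∅ count : ℕ
    ia    = 𝟙 (incident? a g)
    ib    = 𝟙 (incident? b g)
    i∅    = 𝟙 (disjoint? (a , b) g)
    da    = degreeIn E a
    db    = degreeIn E b
    d∅    = disjointCount E (a , b)
    count = length (filter (_≟ₑ (a , b)) E)

  Crosses : Edge n → Edge n → Edge n → Set
  Crosses e f g = Meets g e × Meets g f

  side : Edge n → Fin n → Bool
  side e v = does (v ≟ proj₁ e)

  side-injective : ∀ {e u v} → Incident u e → Incident v e → side e u ≡ side e v → u ≡ v
  side-injective {e} {u} {v} u∈e v∈e same-side with u ≟ proj₁ e | v ≟ proj₁ e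
  ... | yes u≡a | yes v≡a = trans u≡a (sym v≡a)
  ... | no  u≢a | no  v≢a = trans (second u∈e u≢a) (sym (second v∈e v≢a))
    where
    second : ∀ {x} → Incident x e → x ≢ proj₁ e → x ≡ proj₂ e
    second (inj₁ x≡a) x≢a = ⊥-elim (x≢a x≡a)
    second (inj₂ x≡b) _   = x≡b
  side-injective _ _ () | yes _ | no _
  side-injective _ _ () | no _  | yes _

  -- Under Meets, the four possible crossings of disjoint edges e and f form a 4-cycle; parity is its 2-colouring.
  parity : ∀ {e f g} → Crosses e f g → Bool
  parity {e} {f} ((v , _) , (w , _)) = side e v xor side f w

  meeting-crossings-parity-≢ : ∀ {e f g h} → Disjoint e f → Ordered g → Ordered h → g ≢ h → Meets g h →
    (cg : Crosses e f g) (ch : Crosses e f h) → parity cg ≢ parity ch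
  meeting-crossings-parity-≢ {e} {f} {g} {h} e∩f=∅ g< h< g≢h (x , x∈g , x∈h)
    ((v , v∈g , v∈e) , (w , w∈g , w∈f)) ((v' , v'∈h , v'∈e) , (w' , w'∈h , w'∈f)) same-parity =
    [ (λ v≡v' → g≢h (g≡h v≡v' (side-injective w∈f w'∈f (same-f-side v≡v'))))
    , (λ w≡w' → g≢h (g≡h (side-injective v∈e v'∈e (same-e-side w≡w')) w≡w')) ]′ shared-endpoint
    where
    shared-endpoint : v ≡ v' ⊎ w ≡ w'
    shared-endpoint with incident-one-of g (disjoint-≢ e∩f=∅ v∈e w∈f) v∈g w∈g x∈g
                       | incident-one-of h (disjoint-≢ e∩f=∅ v'∈e w'∈f) v'∈h w'∈h x∈h
    ... | inj₁ x≡v | inj₁ x≡v' = inj₁ (trans (sym x≡v) x≡v')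
    ... | inj₂ x≡w | inj₂ x≡w' = inj₂ (trans (sym x≡w) x≡w')
    ... | inj₁ x≡v | inj₂ x≡w' = ⊥-elim (disjoint-≢ e∩f=∅ v∈e w'∈f (trans (sym x≡v) x≡w'))
    ... | inj₂ x≡w | inj₁ x≡v' = ⊥-elim (disjoint-≢ e∩f=∅ v'∈e w∈f (trans (sym x≡v') x≡w))
    g≡h : v ≡ v' → w ≡ w' → g ≡ h
    g≡h refl refl = ordered-edges-≡ g h g< h< (disjoint-≢ e∩f=∅ v∈e w∈f) v∈g w∈g v'∈h w'∈h
    same-f-side : v ≡ v' → side f w ≡ side f w'
    same-f-side refl = ∙-cancelˡ (side e v) (side f w) (side f w') same-parity
    same-e-side : w ≡ w' → side e v ≡ side e v'
    same-e-side refl = ∙-cancelʳ (side f w) (side e v) (side e v') same-parity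

  intersecting-crossings-≤2 : ∀ {e f} → Disjoint e f → (gs : List (Edge n)) → Unique gs → All Ordered gs →
    All (Crosses e f) gs → (∀ {g h} → g ∈ gs → h ∈ gs → Meets g h) → length gs ≤ 2
  intersecting-crossings-≤2 _ []           _ _ _ _ = z≤n
  intersecting-crossings-≤2 _ (_ ∷ [])     _ _ _ _ = s≤s z≤n
  intersecting-crossings-≤2 _ (_ ∷ _ ∷ []) _ _ _ _ = s≤s (s≤s z≤n)
  intersecting-crossings-≤2 e∩f=∅ (_ ∷ _ ∷ _ ∷ _) ((g₁≢g₂ ∷ g₁≢g₃ ∷ _) ∷ (g₂≢g₃ ∷ _) ∷ _)
    (o₁ ∷ o₂ ∷ o₃ ∷ _) (c₁ ∷ c₂ ∷ c₃ ∷ _) meets =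
    ⊥-elim (bool-pigeonhole (parity c₁) (parity c₂) (parity c₃)
      (meeting-crossings-parity-≢ e∩f=∅ o₁ o₂ g₁≢g₂ (meets (here refl) (there (here refl))) c₁ c₂)
      (meeting-crossings-parity-≢ e∩f=∅ o₁ o₃ g₁≢g₃ (meets (here refl) (there (there (here refl)))) c₁ c₃)
      (meeting-crossings-parity-≢ e∩f=∅ o₂ o₃ g₂≢g₃ (meets (there (here refl)) (there (there (here refl)))) c₂ c₃))

  Joined : List (Edge n) → Fin n → Fin n → Set
  Joined E u v = ∃ λ k → k ∈ E × Incident u k × Incident v k

  joined-sym : ∀ {E u v} → Joined E u v → Joined E v u
  joined-sym (k , k∈E , u∈k , v∈k) = k , k∈E , v∈k , u∈k

  joined⇒∈ : ∀ {E u v} → All Ordered E → Joined E u v → toℕ u < toℕ v → (u , v) ∈ E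
  joined⇒∈ {E} E-ordered (k , k∈E , u∈k , v∈k) u<v =
    subst (_∈ E) (ordered-edge-≡ k (All.lookup E-ordered k∈E) u<v u∈k v∈k) k∈E

  TriangleIn : List (Edge n) → Set
  TriangleIn E = ∃ λ α → ∃ λ β → ∃ λ γ →
    (toℕ α < toℕ β) × (toℕ β < toℕ γ) × ((α , β) ∈ E) × ((β , γ) ∈ E) × ((α , γ) ∈ E)

  sorted-triangle : ∀ {E a b x} → All Ordered E → toℕ a < toℕ b → x ≢ a → x ≢ b →
    Joined E a b → Joined E b x → Joined E a x → TriangleIn E
  sorted-triangle {E} {a} {b} {x} E-ordered a<b x≢a x≢b ab bx ax with ℕ.<-cmp (toℕ x) (toℕ a)
  ... | tri< x<a _ _ = x , a , b , x<a , a<b ,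
        joined⇒∈ E-ordered (joined-sym ax) x<a , joined⇒∈ E-ordered ab a<b ,
        joined⇒∈ E-ordered (joined-sym bx) (ℕ.<-trans x<a a<b)
  ... | tri≈ _ x≡a _ = ⊥-elim (x≢a (toℕ-injective x≡a))
  ... | tri> _ _ a<x with ℕ.<-cmp (toℕ x) (toℕ b)
  ...   | tri< x<b _ _ = a , x , b , a<x , x<b ,
          joined⇒∈ E-ordered ax a<x , joined⇒∈ E-ordered (joined-sym bx) x<b , joined⇒∈ E-ordered ab a<b
  ...   | tri≈ _ x≡b _ = ⊥-elim (x≢b (toℕ-injective x≡b))
  ...   | tri> _ _ b<x = a , b , x , a<b , b<x ,
          joined⇒∈ E-ordered ab a<b , joined⇒∈ E-ordered bx b<x , joined⇒∈ E-ordered ax a<x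

  module _ {E : List (Edge n)} (E-ordered : All Ordered E) (E-unique : Unique E) where

    private
      ordered-∈ : ∀ {k} → k ∈ E → Ordered k
      ordered-∈ = All.lookup E-ordered

      noDisjoint? : ∀ g → Dec (disjointCount E g ≡ 0)
      noDisjoint? g = disjointCount E g ℕ.≟ 0

      withDisjoint : ℕ
      withDisjoint = length (filter (∁? noDisjoint?) E)

      meets-all : ∀ {g h} → g ∈ filter noDisjoint? E → h ∈ E → Meets g h
      meets-all g∈ = disjointCount≡0⇒meets (proj₂ (∈-filter⁻ noDisjoint? {xs = E} g∈))

    length-noDisjoint-≤2 : ∀ {e f} → e ∈ E → f ∈ E → Disjoint e f → length (filter noDisjoint? E) ≤ 2
    length-noDisjoint-≤2 e∈E f∈E e∩f=∅ = intersecting-crossings-≤2 e∩f=∅ (filter noDisjoint? E)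
      (filter⁺ noDisjoint? E-unique) (All.filter⁺ noDisjoint? E-ordered)
      (All.tabulate λ g∈ → meets-all g∈ e∈E , meets-all g∈ f∈E)
      (λ g∈ h∈ → meets-all g∈ (proj₁ (∈-filter⁻ noDisjoint? {xs = E} h∈)))

    length-≤-withDisjoint+withDisjoint : ∀ {e f} → e ∈ E → f ∈ E → Disjoint e f →
      length E ≤ withDisjoint + withDisjoint
    length-≤-withDisjoint+withDisjoint {e} {f} e∈E f∈E e∩f=∅ = begin
      length E                                     ≡⟨ length-filter+length-filter-∁ noDisjoint? E ⟨
      length (filter noDisjoint? E) + withDisjoint ≤⟨ ℕ.+-monoˡ-≤ withDisjoint (length-noDisjoint-≤2 e∈E f∈E e∩f=∅) ⟩
      2 + withDisjoint                             ≤⟨ ℕ.+-monoˡ-≤ withDisjoint 2≤withDisjoint ⟩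
      withDisjoint + withDisjoint                  ∎
      where
      open ℕ.≤-Reasoning
      e≢f : e ≢ f
      e≢f e≡f = proj₁ e∩f=∅ (inj₁ (cong proj₁ e≡f))
      2≤withDisjoint : 2 ≤ withDisjoint
      2≤withDisjoint = length-≤-⊆ _≟ₑ_ ((e≢f ∷ []) ∷ [] ∷ []) λ
        { (here refl)         → ∈-filter⁺ (∁? noDisjoint?) e∈E
                                  (λ e0 → disjoint⇒¬meets e∩f=∅ (disjointCount≡0⇒meets e0 f∈E))
        ; (there (here refl)) → ∈-filter⁺ (∁? noDisjoint?) f∈E
                                  (λ f0 → disjoint⇒¬meets e∩f=∅ (meets-sym (disjointCount≡0⇒meets f0 e∈E))) }

    length-≤-disjointPairs+disjointPairs : disjointPairs E ≢ 0 → length E ≤ disjointPairs E + disjointPairs E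
    length-≤-disjointPairs+disjointPairs D≢0
      with e , e∈E , e-count≢0 ← ∃-of-sum≢0 (disjointCount E) E D≢0
      with f , f∈E , e∩f=∅ ← ∃-of-length-filter≢0 (disjoint? e) E e-count≢0
      = ℕ.≤-trans (length-≤-withDisjoint+withDisjoint e∈E f∈E e∩f=∅) (ℕ.+-mono-≤ N≤D N≤D)
      where
      N≤D : withDisjoint ≤ disjointPairs E
      N≤D = length-filter-≢0≤sum (disjointCount E) E

    module _ (intersecting : ∀ {g h} → g ∈ E → h ∈ E → Meets g h) where

      triangle-sides : ∀ {a b x g h} → (a , b) ∈ E → g ∈ E → h ∈ E → x ≢ a → x ≢ b →
        Incident b g → Incident x g → Incident a h → Incident x h → E ⊆ ((a , b) ∷ g ∷ h ∷ [])
      triangle-sides {a} {b} {x} {g} {h} e∈E g∈E h∈E x≢a x≢b b∈g x∈g a∈h x∈h {k} k∈E =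
        [ through-a , through-b ]′ (meets-edge (intersecting k∈E e∈E))
        where
        a≢b : a ≢ b
        a≢b = ordered⇒loopless (ordered-∈ e∈E)
        k≡ : ∀ {u v} (s : Edge n) → s ∈ E → u ≢ v → Incident u k → Incident v k → Incident u s → Incident v s → k ≡ s
        k≡ s s∈E = ordered-edges-≡ k s (ordered-∈ k∈E) (ordered-∈ s∈E)
        through-a : Incident a k → k ∈ ((a , b) ∷ g ∷ h ∷ [])
        through-a a∈k with y , y∈k , y∈g ← intersecting k∈E g∈E
          with incident-one-of g (λ b≡x → x≢b (sym b≡x)) b∈g x∈g y∈g
        ... | inj₁ refl = here (k≡ (a , b) e∈E a≢b a∈k y∈k (inj₁ refl) (inj₂ refl))
        ... | inj₂ refl = there (there (here (k≡ h h∈E (λ a≡x → x≢a (sym a≡x)) a∈k y∈k a∈h x∈h)))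
        through-b : Incident b k → k ∈ ((a , b) ∷ g ∷ h ∷ [])
        through-b b∈k with y , y∈k , y∈h ← intersecting k∈E h∈E
          with incident-one-of h (λ a≡x → x≢a (sym a≡x)) a∈h x∈h y∈h
        ... | inj₁ refl = here (k≡ (a , b) e∈E a≢b y∈k b∈k (inj₁ refl) (inj₂ refl))
        ... | inj₂ refl = there (here (k≡ g g∈E (λ b≡x → x≢b (sym b≡x)) b∈k y∈k b∈g x∈g))

      non-star⇒triangle : ∀ {a b g h} → (a , b) ∈ E → g ∈ E → ¬ Incident a g → h ∈ E → ¬ Incident b h →
        (length E ≡ 3) × TriangleIn E
      non-star⇒triangle {a} {b} {g} {h} e∈E g∈E a∉g h∈E b∉h
        with x , x∈g , x∈h ← intersecting g∈E h∈E
        = length≡3 , sorted-triangle E-ordered (ordered-∈ e∈E) x≢a x≢b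
                       ((a , b) , e∈E , inj₁ refl , inj₂ refl) (g , g∈E , b∈g , x∈g) (h , h∈E , a∈h , x∈h)
        where
        b∈g : Incident b g
        b∈g = [ (λ a∈g → ⊥-elim (a∉g a∈g)) , (λ b∈g → b∈g) ]′ (meets-edge (intersecting g∈E e∈E))
        a∈h : Incident a h
        a∈h = [ (λ a∈h → a∈h) , (λ b∈h → ⊥-elim (b∉h b∈h)) ]′ (meets-edge (intersecting h∈E e∈E))
        x≢a : x ≢ a
        x≢a refl = a∉g x∈g
        x≢b : x ≢ b
        x≢b refl = b∉h x∈h
        sides-distinct : Unique ((a , b) ∷ g ∷ h ∷ [])
        sides-distinct = ((λ { refl → a∉g (inj₁ refl) }) ∷ (λ { refl → b∉h (inj₂ refl) }) ∷ [])
                       ∷ ((λ { refl → a∉g a∈h }) ∷ []) ∷ [] ∷ []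
        length≡3 : length E ≡ 3
        length≡3 = ℕ.≤-antisym
          (length-≤-⊆ _≟ₑ_ E-unique (triangle-sides e∈E g∈E h∈E x≢a x≢b b∈g x∈g a∈h x∈h))
          (length-≤-⊆ _≟ₑ_ sides-distinct
            λ { (here refl) → e∈E ; (there (here refl)) → g∈E ; (there (there (here refl))) → h∈E })

      intersecting⇒star-or-triangle : ∀ {e} → e ∈ E →
        (∃ λ c → All (Incident c) E) ⊎ ((length E ≡ 3) × TriangleIn E)
      intersecting⇒star-or-triangle {a , b} e∈E with All.all? (incident? a) E | All.all? (incident? b) E
      ... | yes all-a | _         = inj₁ (a , all-a)
      ... | no  _     | yes all-b = inj₁ (b , all-b)
      ... | no ¬all-a | no ¬all-b
        with g , g∈E , a∉g ← find (All.¬All⇒Any¬ (incident? a) E ¬all-a)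
        with h , h∈E , b∉h ← find (All.¬All⇒Any¬ (incident? b) E ¬all-b)
        = inj₂ (non-star⇒triangle e∈E g∈E a∉g h∈E b∉h)

  degreeSum : SimpleGraph n → Edge n → ℕ
  degreeSum G e = degree G (proj₁ e) + degree G (proj₂ e)

  sumSqDeg≡sum-degreeSum : ∀ G → sumSqDeg G ≡ sum (map (degreeSum G) (edges G))
  sumSqDeg≡sum-degreeSum G = sum-degreeIn-* (edges G) (All.map ordered⇒loopless (ordered G)) (degree G)

  ∃-sumSqDeg≤numEdges*degreeSum : ∀ G .{{_ : NonZero (numEdges G)}} →
    ∃ λ e → e ∈ edges G × sumSqDeg G ≤ numEdges G * degreeSum G e
  ∃-sumSqDeg≤numEdges*degreeSum G with e , e∈E , sum≤ ← ∃-sum≤length* (degreeSum G) (edges G) =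
    e , e∈E , subst (_≤ numEdges G * degreeSum G e) (sym (sumSqDeg≡sum-degreeSum G)) sum≤

  degreeSum+disjointCount : ∀ G {e} → e ∈ edges G → degreeSum G e + disjointCount (edges G) e ≡ numEdges G + 1
  degreeSum+disjointCount G {a , b} e∈E =
    trans (degreeIn-+-disjointCount (edges G) (ordered G) (All.lookup (ordered G) e∈E))
          (cong (numEdges G +_) (count-unique _≟ₑ_ (unique G) e∈E))

  sumSqDeg+disjointPairs : ∀ G → sumSqDeg G + disjointPairs (edges G) ≡ numEdges G * (numEdges G + 1)
  sumSqDeg+disjointPairs G = begin
    sumSqDeg G + disjointPairs E
      ≡⟨ cong (_+ disjointPairs E) (sumSqDeg≡sum-degreeSum G) ⟩
    sum (map (degreeSum G) E) + sum (map (disjointCount E) E)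
      ≡⟨ sum-map-+ (degreeSum G) (disjointCount E) E ⟨
    sum (map (λ e → degreeSum G e + disjointCount E e) E)
      ≡⟨ sum-map-const (All.tabulate (degreeSum+disjointCount G)) ⟩
    numEdges G * (numEdges G + 1) ∎
    where
    open ≡-Reasoning
    E : List (Edge n)
    E = edges G

-- Imported only now, so that from here on _≤_ and _<_ are the orders on ℚ rather than on ℕ.
open import Data.Integer using (+_)
import Data.Integer as ℤ
import Data.Integer.Properties as ℤ
open import Data.Rational using (ℚ; _≤_; _<_; _-_; ½; 0ℚ; 1ℚ; _/_; Positive; toℚᵘ)
import Data.Rational as ℚ
import Data.Rational.Properties as ℚ
import Data.Rational.Unnormalised as ℚᵘ
import Data.Rational.Unnormalised.Properties as ℚᵘ
open import Data.Rational.Solver using (module +-*-Solver)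
open import Algebra.Properties.Semiring.Mult (CommutativeRing.semiring ℚ.+-*-commutativeRing)
  using (×-homo-+; ×1-homo-*) renaming (_×_ to _×ℚ_)

toℚᵘ-ℕ→ℚ : ∀ k → toℚᵘ (ℕ→ℚ k) ℚᵘ.≃ ℚᵘ.mkℚᵘ (+ k) 0
toℚᵘ-ℕ→ℚ k = ℚ.toℚᵘ-fromℚᵘ (ℚᵘ.mkℚᵘ (+ k) 0)

ℕ→ℚ-suc : ∀ k → ℕ→ℚ (suc k) ≡ 1ℚ ℚ.+ ℕ→ℚ k
ℕ→ℚ-suc k = ℚ.toℚᵘ-injective (begin
  toℚᵘ (ℕ→ℚ (suc k))                      ≈⟨ toℚᵘ-ℕ→ℚ (suc k) ⟩
  ℚᵘ.mkℚᵘ (+ suc k) 0                     ≈⟨ ℚᵘ.*≡* (cong (λ z → (+ 1 ℤ.+ z) ℤ.* + 1) (sym (ℤ.*-identityʳ (+ k)))) ⟩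
  ℚᵘ.mkℚᵘ (+ 1) 0 ℚᵘ.+ ℚᵘ.mkℚᵘ (+ k) 0     ≈⟨ ℚᵘ.+-cong (toℚᵘ-ℕ→ℚ 1) (toℚᵘ-ℕ→ℚ k) ⟨
  toℚᵘ 1ℚ ℚᵘ.+ toℚᵘ (ℕ→ℚ k)               ≈⟨ ℚ.toℚᵘ-homo-+ 1ℚ (ℕ→ℚ k) ⟨
  toℚᵘ (1ℚ ℚ.+ ℕ→ℚ k)                     ∎)
  where open ℚᵘ.≃-Reasoning

ℕ→ℚ≡×1ℚ : ∀ k → ℕ→ℚ k ≡ k ×ℚ 1ℚ
ℕ→ℚ≡×1ℚ zero    = refl
ℕ→ℚ≡×1ℚ (suc k) = trans (ℕ→ℚ-suc k) (cong (1ℚ ℚ.+_) (ℕ→ℚ≡×1ℚ k))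

ℕ→ℚ-homo-+ : ∀ a b → ℕ→ℚ (a + b) ≡ ℕ→ℚ a ℚ.+ ℕ→ℚ b
ℕ→ℚ-homo-+ a b rewrite ℕ→ℚ≡×1ℚ a | ℕ→ℚ≡×1ℚ b | ℕ→ℚ≡×1ℚ (a + b) = ×-homo-+ 1ℚ a b

ℕ→ℚ-homo-* : ∀ a b → ℕ→ℚ (a * b) ≡ ℕ→ℚ a ℚ.* ℕ→ℚ b
ℕ→ℚ-homo-* a b rewrite ℕ→ℚ≡×1ℚ a | ℕ→ℚ≡×1ℚ b | ℕ→ℚ≡×1ℚ (a * b) = ×1-homo-* a b

ℕ→ℚ-mono-≤ : ∀ {a b} → a ℕ.≤ b → ℕ→ℚ a ≤ ℕ→ℚ b
ℕ→ℚ-mono-≤ {a} {b} a≤b = ℚ.toℚᵘ-cancel-≤ (ℚᵘ.≤-respʳ-≃ (ℚᵘ.≃-sym (toℚᵘ-ℕ→ℚ b))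
  (ℚᵘ.≤-respˡ-≃ (ℚᵘ.≃-sym (toℚᵘ-ℕ→ℚ a)) (ℚᵘ.*≤* (ℤ.*-monoʳ-≤-nonNeg (+ 1) (ℤ.+≤+ a≤b)))))

ℕ→ℚ-mono-< : ∀ {a b} → a ℕ.< b → ℕ→ℚ a < ℕ→ℚ b
ℕ→ℚ-mono-< {a} {b} a<b = ℚ.toℚᵘ-cancel-< (ℚᵘ.<-respʳ-≃ (ℚᵘ.≃-sym (toℚᵘ-ℕ→ℚ b))
  (ℚᵘ.<-respˡ-≃ (ℚᵘ.≃-sym (toℚᵘ-ℕ→ℚ a)) (ℚᵘ.*<* (ℤ.*-monoʳ-<-pos (+ 1) (ℤ.+<+ a<b)))))

ℕ→ℚ-pos : ∀ k .{{_ : NonZero k}} → Positive (ℕ→ℚ k)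
ℕ→ℚ-pos k = ℚ.positive (ℕ→ℚ-mono-< (ℕ.>-nonZero⁻¹ k))

+a/k*k≡a : ∀ a k .{{_ : NonZero k}} → (+ a / k) ℚ.* ℕ→ℚ k ≡ ℕ→ℚ a
+a/k*k≡a a (suc k) = ℚ.toℚᵘ-injective (begin
  toℚᵘ ((+ a / suc k) ℚ.* ℕ→ℚ (suc k))          ≈⟨ ℚ.toℚᵘ-homo-* (+ a / suc k) (ℕ→ℚ (suc k)) ⟩
  toℚᵘ (+ a / suc k) ℚᵘ.* toℚᵘ (ℕ→ℚ (suc k))    ≈⟨ ℚᵘ.*-cong (ℚ.toℚᵘ-fromℚᵘ (ℚᵘ.mkℚᵘ (+ a) k)) (toℚᵘ-ℕ→ℚ (suc k)) ⟩
  ℚᵘ.mkℚᵘ (+ a) k ℚᵘ.* ℚᵘ.mkℚᵘ (+ suc k) 0      ≈⟨ ℚᵘ.*≡* (trans (ℤ.*-identityʳ _) (cong (λ d → + a ℤ.* + d) (sym (ℕ.*-identityʳ (suc k))))) ⟩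
  ℚᵘ.mkℚᵘ (+ a) 0                               ≈⟨ toℚᵘ-ℕ→ℚ a ⟨
  toℚᵘ (ℕ→ℚ a)                                  ∎)
  where open ℚᵘ.≃-Reasoning

*-cancelʳ-≡-pos : ∀ {p q} r .{{_ : Positive r}} → p ℚ.* r ≡ q ℚ.* r → p ≡ q
*-cancelʳ-≡-pos r pr≡qr =
  ℚ.≤-antisym (ℚ.*-cancelʳ-≤-pos r (ℚ.≤-reflexive pr≡qr)) (ℚ.*-cancelʳ-≤-pos r (ℚ.≤-reflexive (sym pr≡qr)))

module _ {n : ℕ} (G : SimpleGraph n) .{{_ : NonZero (numEdges G)}} where

  private
    m : ℕ
    m = numEdges G

    instance
      m-positive : Positive (ℕ→ℚ m)
      m-positive = ℕ→ℚ-pos m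

    open +-*-Solver

  delta*numEdges≡disjointPairs : delta G ℚ.* ℕ→ℚ (numEdges G) ≡ ℕ→ℚ (disjointPairs (edges G))
  delta*numEdges≡disjointPairs = begin
    (ℕ→ℚ (m + 1) - X) ℚ.* M                 ≡⟨ ℚ.*-distribʳ-+ M (ℕ→ℚ (m + 1)) (ℚ.- X) ⟩
    ℕ→ℚ (m + 1) ℚ.* M ℚ.+ (ℚ.- X) ℚ.* M     ≡⟨ cong (ℕ→ℚ (m + 1) ℚ.* M ℚ.+_) (ℚ.neg-distribˡ-* X M) ⟨
    ℕ→ℚ (m + 1) ℚ.* M - X ℚ.* M             ≡⟨ cong₂ _-_ (sym (ℕ→ℚ-homo-* (m + 1) m)) (+a/k*k≡a S m) ⟩
    ℕ→ℚ ((m + 1) * m) - ℕ→ℚ S               ≡⟨ cong (λ k → ℕ→ℚ k - ℕ→ℚ S) m[m+1]≡S+D ⟩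
    ℕ→ℚ (S + D) - ℕ→ℚ S                     ≡⟨ cong (_- ℕ→ℚ S) (ℕ→ℚ-homo-+ S D) ⟩
    (ℕ→ℚ S ℚ.+ ℕ→ℚ D) - ℕ→ℚ S               ≡⟨ solve 2 (λ s d → (s :+ d) :- s := d) refl (ℕ→ℚ S) (ℕ→ℚ D) ⟩
    ℕ→ℚ D                                   ∎
    where
    open ≡-Reasoning
    S D : ℕ
    S = sumSqDeg G
    D = disjointPairs (edges G)
    M X : ℚ
    M = ℕ→ℚ m
    X = + S / m
    m[m+1]≡S+D : (m + 1) * m ≡ S + D
    m[m+1]≡S+D = trans (ℕ.*-comm (m + 1) m) (sym (sumSqDeg+disjointPairs G))

  numEdges-delta≤ : ∀ {s} → sumSqDeg G ℕ.≤ numEdges G * s → ℕ→ℚ (numEdges G) - delta G ≤ ℕ→ℚ s - 1ℚ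
  numEdges-delta≤ {s} S≤m*s = begin
    M - (ℕ→ℚ (m + 1) - X) ≡⟨ cong (λ q → M - (q - X)) (ℕ→ℚ-homo-+ m 1) ⟩
    M - ((M ℚ.+ 1ℚ) - X)  ≡⟨ solve 2 (λ M X → M :- ((M :+ con 1ℚ) :- X) := X :- con 1ℚ) refl M X ⟩
    X - 1ℚ                ≤⟨ ℚ.+-monoˡ-≤ (ℚ.- 1ℚ) X≤s ⟩
    ℕ→ℚ s - 1ℚ            ∎
    where
    open ℚ.≤-Reasoning
    M X : ℚ
    M = ℕ→ℚ m
    X = + sumSqDeg G / m
    X≤s : X ≤ ℕ→ℚ s
    X≤s = ℚ.*-cancelʳ-≤-pos M (begin
      X ℚ.* M           ≡⟨ +a/k*k≡a (sumSqDeg G) m ⟩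
      ℕ→ℚ (sumSqDeg G)  ≤⟨ ℕ→ℚ-mono-≤ (subst (sumSqDeg G ℕ.≤_) (ℕ.*-comm m s) S≤m*s) ⟩
      ℕ→ℚ (s * m)       ≡⟨ ℕ→ℚ-homo-* s m ⟩
      ℕ→ℚ s ℚ.* M       ∎)

  delta<½⇒disjointPairs≡0 : delta G < ½ → disjointPairs (edges G) ≡ 0
  delta<½⇒disjointPairs≡0 δ<½ with disjointPairs (edges G) ℕ.≟ 0
  ... | yes D≡0 = D≡0
  ... | no  D≢0 = ⊥-elim (ℚ.<-irrefl refl (ℚ.<-≤-trans δ<½ ½≤δ))
    where
    open ℚ.≤-Reasoning
    D : ℚ
    D = ℕ→ℚ (disjointPairs (edges G))
    ½≤δ : ½ ≤ delta G
    ½≤δ = ℚ.*-cancelʳ-≤-pos (ℕ→ℚ m) (begin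
      ½ ℚ.* ℕ→ℚ m     ≤⟨ ℚ.*-monoˡ-≤-nonNeg ½ (ℕ→ℚ-mono-≤ (length-≤-disjointPairs+disjointPairs (ordered G) (unique G) D≢0)) ⟩
      ½ ℚ.* ℕ→ℚ (disjointPairs (edges G) + disjointPairs (edges G))
                      ≡⟨ cong (½ ℚ.*_) (ℕ→ℚ-homo-+ (disjointPairs (edges G)) (disjointPairs (edges G))) ⟩
      ½ ℚ.* (D ℚ.+ D) ≡⟨ solve 1 (λ d → con ½ :* (d :+ d) := d) refl D ⟩
      D               ≡⟨ delta*numEdges≡disjointPairs ⟨
      delta G ℚ.* ℕ→ℚ m ∎)

  disjointPairs≡0⇒delta≡0 : disjointPairs (edges G) ≡ 0 → delta G ≡ 0ℚ
  disjointPairs≡0⇒delta≡0 D≡0 = *-cancelʳ-≡-pos (ℕ→ℚ m)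
    (trans delta*numEdges≡disjointPairs (trans (cong ℕ→ℚ D≡0) (sym (ℚ.*-zeroˡ (ℕ→ℚ m)))))

lemma1 : ∀ {n} (G : SimpleGraph n) → .{{_ : NonZero (numEdges G)}} →
    (∃ λ (u : Fin n) → ∃ λ (v : Fin n) → ((u , v) ∈ edges G) ×
        (ℕ→ℚ (numEdges G) - delta G ≤ ℕ→ℚ (degree G u + degree G v) - 1ℚ))
    × (delta G < ½ → (delta G ≡ 0ℚ) × (IsStar G ⊎ IsTriangle G))
lemma1 G = (proj₁ e , proj₂ e , e∈E , numEdges-delta≤ G sumSqDeg≤) , small-delta
  where
  best : ∃ λ e → e ∈ edges G × sumSqDeg G ℕ.≤ numEdges G * degreeSum G e
  best = ∃-sumSqDeg≤numEdges*degreeSum G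
  e : Edge _
  e = proj₁ best
  e∈E : e ∈ edges G
  e∈E = proj₁ (proj₂ best)
  sumSqDeg≤ : sumSqDeg G ℕ.≤ numEdges G * degreeSum G e
  sumSqDeg≤ = proj₂ (proj₂ best)
  intersecting : disjointPairs (edges G) ≡ 0 → ∀ {g h} → g ∈ edges G → h ∈ edges G → Meets g h
  intersecting D≡0 g∈E = disjointCount≡0⇒meets (sum-map≡0⇒≡0 (disjointCount (edges G)) (edges G) D≡0 g∈E)
  small-delta : delta G < ½ → (delta G ≡ 0ℚ) × (IsStar G ⊎ IsTriangle G)
  small-delta δ<½ = disjointPairs≡0⇒delta≡0 G D≡0 ,
                    intersecting⇒star-or-triangle (ordered G) (unique G) (intersecting D≡0) e∈E
    where
    D≡0 : disjointPairs (edges G) ≡ 0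
    D≡0 = delta<½⇒disjointPairs≡0 G δ<½
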